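{- Let $G=(V,E)$ be an undirected graph with $n$ vertices and $m$ edges, and consider any sequence $m_1,\ldots,m_{n-1}$ of merge operations, starting from the $n$ singleton clusters, where $m_i=(u_i,v_i)$ merges two distinct current clusters $u_i,v_i$ into the cluster $u_i\cup v_i$. Let $\mathsf{Cost}(m_i)=\min(d(u_i),d(v_i))$, where $d(u_i)$ and $d(v_i)$ are the degrees of the clusters at the time they are merged. Then $\sum_{i=1}^{n-1}\mathsf{Cost}(m_i)=O(m\log n)$.
   Context: At any time, the current clusters partition $V$ and form a graph (without self-loops or parallel edges) in which two distinct clusters $X,Y$ are adjacent iff some edge of $G$ joins a vertex of $X$ to a vertex of $Y$; the degree $d(X)$ of a cluster is its number of adjacent clusters. Asymptotic bounds assume $m=\Omega(n)$. -}

module Defs where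

open import Data.Nat using (ℕ; zero; suc; _+_; _<_; _⊔_; _⊓_)
open import Data.Fin using (Fin; toℕ; _≟_)
open import Data.Fin.Properties using () 
open import Data.Bool using (Bool; true; false; _∧_; _∨_; not; if_then_else_)
open import Data.List using (List; []; _∷_; length; filter)
open import Data.Bool.ListAction using (any)
open import Data.List.Base using (allFin)
open import Data.List.Relation.Unary.All using (All)
open import Data.List.Relation.Unary.Unique.Propositional using (Unique)
open import Data.Product using (Σ; _×_; _,_; ∃)
open import Data.Unit using (⊤)
open import Relation.Nullary using (does; ¬_)
open import Relation.Nullary.Decidable using (⌊_⌋)
open import Relation.Binary.PropositionalEquality using (_≡_; _≢_)
open import Function using (id)

-- A simple undirected graph on vertex set Fin n, given by its edge list.
-- Each edge {u,v} is stored once, in canonical orientation u < v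
-- (so no self-loops), and the list has no duplicates (no parallel edges).
-- The number of edges m is the length of the list.
SimpleEdges : {n : ℕ} → List (Fin n × Fin n) → Set
SimpleEdges E = All (λ { (u , v) → toℕ u < toℕ v }) E × Unique E

-- A clustering is a labelling  f : Fin n → Fin n ; the cluster with label a
-- is the set of vertices x with  f x ≡ a  (a label is a current cluster iff
-- this set is nonempty).  Initially  f = id  (n singleton clusters).

_==_ : {n : ℕ} → Fin n → Fin n → Bool
a == b = does (a ≟ b)

adjacent : {n : ℕ} → List (Fin n × Fin n) → (Fin n → Fin n) → Fin n → Fin n → Bool
adjacent E f a b =
  any (λ { (u , v) → ((f u == a) ∧ (f v == b)) ∨ ((f u == b) ∧ (f v == a)) }) E

degree : {n : ℕ} → List (Fin n × Fin n) → (Fin n → Fin n) → Fin n → ℕ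
degree {n} E f a =
  length (filter (λ b → Data.Bool.T? (not (b == a) ∧ adjacent E f a b)) (allFin n))
  where import Data.Bool

IsCluster : {n : ℕ} → (Fin n → Fin n) → Fin n → Set
IsCluster f a = ∃ λ x → f x ≡ a

merge : {n : ℕ} → (Fin n → Fin n) → Fin n → Fin n → (Fin n → Fin n)
merge f a b x = if f x == b then a else f x

ValidMerges : {n : ℕ} → (Fin n → Fin n) → List (Fin n × Fin n) → Set
ValidMerges f [] = ⊤
ValidMerges f ((a , b) ∷ ms) =
  a ≢ b × IsCluster f a × IsCluster f b × ValidMerges (merge f a b) ms

totalCost : {n : ℕ} → List (Fin n × Fin n) → (Fin n → Fin n) → List (Fin n × Fin n) → ℕ
totalCost E f [] = 0
totalCost E f ((a , b) ∷ ms) =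
  (degree E f a ⊓ degree E f b) + totalCost E (merge f a b) ms

-- Give every edge endpoint x the weight ⌈log₂ vol (C x)⌉, where C x is the cluster of x and the
-- volume of a cluster is the number of edge endpoints in it; the potential is the total weight.
-- A cluster's degree is at most its volume, and in a merge every endpoint of the cluster of smaller
-- volume sees its volume at least double, so the potential grows by at least the cost of the merge.
-- The potential never exceeds 2m ⌈log₂ 2m⌉, and m ≤ n² gives ⌈log₂ 2m⌉ ≤ 3 ⌈log₂ n⌉.
module Submission where

open import Defs
open import Data.Nat using (ℕ; _*_; _≤_; _∸_)
open import Data.Nat.Logarithm using (⌈log₂_⌉)
open import Data.Fin using (Fin)
open import Data.List using (List; length)
open import Data.Product using (Σ; _×_)
open import Relation.Binary.PropositionalEquality using (_≡_)
open import Function using (id)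

open import Algebra.Properties.CommutativeSemigroup using (interchange; xy∙z≈xz∙y)
open import Data.Bool using (Bool; true; false; _∧_; _∨_; not; if_then_else_; T?)
open import Data.Bool.Properties using (∧-comm; if-float)
open import Data.Empty using (⊥-elim)
open import Data.Fin as Fin using (_≟_; toℕ; combine)
open import Data.Fin.Properties using (toℕ<n; combine-injective; injective⇒≤)
open import Data.List using ([]; _∷_; filter; allFin; lookup)
open import Data.List.Membership.Propositional using (_∈_)
open import Data.List.Membership.Propositional.Properties using (∈-lookup)
open import Data.List.Relation.Unary.All as All using (All; []; _∷_)
open import Data.List.Relation.Unary.AllPairs using ([]; _∷_)
open import Data.List.Relation.Unary.Any using (here; there)
open import Data.List.Relation.Unary.Unique.Propositional using (Unique)
open import Data.List.Relation.Unary.Unique.Propositional.Properties using (allFin⁺)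
open import Data.Nat using (suc; _+_; _⊓_; _<_; _≤ᵇ_; _^_; z≤n; s≤s; ⌊_/2⌋; ⌈_/2⌉)
open import Data.Nat.Induction using (<-wellFounded)
open import Data.Nat.Logarithm using (⌈log₂⌉-mono-≤; ⌈log₂2*n⌉≡1+⌈log₂n⌉; ⌈log₂2^n⌉≡n)
open import Data.Nat.Logarithm.Core using (⌈log2⌉)
open import Data.Nat.Properties hiding (_≟_)
open import Data.Nat.Solver using (module +-*-Solver)
open import Data.Product using (_,_; uncurry)
open import Data.Product.Properties using (×-≡,≡→≡)
open import Function.Definitions using (Injective)
open import Induction.WellFounded using (Acc; acc)
open import Relation.Binary.PropositionalEquality using (_≢_; refl; sym; ≢-sym; trans; cong; cong₂; subst; subst₂; module ≡-Reasoning)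
open import Relation.Nullary using (yes; no)
open import Relation.Nullary.Decidable using (dec-true; dec-false)
open import Relation.Nullary.Reflects using (Reflects; ofʸ; ofⁿ)

𝟙 : Bool → ℕ
𝟙 true  = 1
𝟙 false = 0

module _ {A : Set} where

  sumBy : (A → ℕ) → List A → ℕ
  sumBy g []       = 0
  sumBy g (x ∷ xs) = g x + sumBy g xs

  count : (A → Bool) → List A → ℕ
  count p = sumBy (λ x → 𝟙 (p x))

  sumBy-mono-All : {g h : A → ℕ} {xs : List A} → All (λ x → g x ≤ h x) xs → sumBy g xs ≤ sumBy h xs
  sumBy-mono-All []         = z≤n
  sumBy-mono-All (le ∷ les) = +-mono-≤ le (sumBy-mono-All les)

  sumBy-mono : {g h : A → ℕ} (xs : List A) → (∀ x → g x ≤ h x) → sumBy g xs ≤ sumBy h xs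
  sumBy-mono xs le = sumBy-mono-All (All.universal le xs)

  sumBy-cong : {g h : A → ℕ} (xs : List A) → (∀ x → g x ≡ h x) → sumBy g xs ≡ sumBy h xs
  sumBy-cong []       eq = refl
  sumBy-cong (x ∷ xs) eq = cong₂ _+_ (eq x) (sumBy-cong xs eq)

  sumBy-+ : (g h : A → ℕ) (xs : List A) → sumBy (λ x → g x + h x) xs ≡ sumBy g xs + sumBy h xs
  sumBy-+ g h []       = refl
  sumBy-+ g h (x ∷ xs) = trans (cong (g x + h x +_) (sumBy-+ g h xs))
                              (interchange +-commutativeSemigroup (g x) (h x) (sumBy g xs) (sumBy h xs))

  sumBy-≤-length* : {g : A → ℕ} {k : ℕ} (xs : List A) → (∀ x → g x ≤ k) → sumBy g xs ≤ length xs * k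
  sumBy-≤-length* []       le = z≤n
  sumBy-≤-length* (x ∷ xs) le = +-mono-≤ (le x) (sumBy-≤-length* xs le)

  count≤length : (p : A → Bool) (xs : List A) → count p xs ≤ length xs
  count≤length p xs = subst (count p xs ≤_) (*-identityʳ (length xs)) (sumBy-≤-length* xs (λ x → 𝟙≤1 (p x)))
    where
    𝟙≤1 : ∀ b → 𝟙 b ≤ 1
    𝟙≤1 true  = ≤-refl
    𝟙≤1 false = z≤n

  count-∨ : (p q : A → Bool) (xs : List A) → count (λ x → p x ∨ q x) xs ≤ count p xs + count q xs
  count-∨ p q xs = ≤-trans (sumBy-mono xs (λ x → 𝟙-∨ (p x) (q x))) (≤-reflexive (sumBy-+ _ _ xs))
    where
    𝟙-∨ : ∀ b c → 𝟙 (b ∨ c) ≤ 𝟙 b + 𝟙 c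
    𝟙-∨ true  c = s≤s z≤n
    𝟙-∨ false c = ≤-refl

  count-∧ˡ : (p q : A → Bool) (xs : List A) → count (λ x → p x ∧ q x) xs ≤ count q xs
  count-∧ˡ p q xs = sumBy-mono xs (λ x → 𝟙-∧ (p x) (q x))
    where
    𝟙-∧ : ∀ b c → 𝟙 (b ∧ c) ≤ 𝟙 c
    𝟙-∧ true  c = ≤-refl
    𝟙-∧ false c = z≤n

  sumBy-zero : (xs : List A) → sumBy (λ _ → 0) xs ≡ 0
  sumBy-zero []       = refl
  sumBy-zero (x ∷ xs) = sumBy-zero xs

  count-∈ : (p : A → Bool) {x : A} {xs : List A} → x ∈ xs → p x ≡ true → 0 < count p xs
  count-∈ p (here refl) px = ≤-trans (≤-reflexive (cong 𝟙 (sym px))) (m≤m+n _ _)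
  count-∈ p (there x∈)  px = ≤-trans (count-∈ p x∈ px) (m≤n+m _ _)

  length-filter-T? : (p : A → Bool) (xs : List A) → length (filter (λ x → T? (p x)) xs) ≡ count p xs
  length-filter-T? p []       = refl
  length-filter-T? p (x ∷ xs) with p x
  ... | true  = cong suc (length-filter-T? p xs)
  ... | false = length-filter-T? p xs

  lookup-injective : {xs : List A} → Unique xs → Injective _≡_ _≡_ (lookup xs)
  lookup-injective (x∉ ∷ u) {Fin.zero}  {Fin.zero}  eq = refl
  lookup-injective (x∉ ∷ u) {Fin.zero}  {Fin.suc j} eq = ⊥-elim (All.lookup x∉ (∈-lookup j) eq)
  lookup-injective (x∉ ∷ u) {Fin.suc i} {Fin.zero}  eq = ⊥-elim (All.lookup x∉ (∈-lookup i) (sym eq))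
  lookup-injective (x∉ ∷ u) {Fin.suc i} {Fin.suc j} eq = cong Fin.suc (lookup-injective u eq)

module _ {n : ℕ} where

  ==-refl : (a : Fin n) → (a == a) ≡ true
  ==-refl a = dec-true (a ≟ a) refl

  ==-false : {a b : Fin n} → a ≢ b → (a == b) ≡ false
  ==-false {a} {b} = dec-false (a ≟ b)

  ==-if-a : {a b : Fin n} → a ≢ b → ∀ c → (a == (if c then a else b)) ≡ c
  ==-if-a {a} _   true  = ==-refl a
  ==-if-a     a≢b false = ==-false a≢b

  ==-if-b : {a b : Fin n} → a ≢ b → ∀ c → (b == (if c then a else b)) ≡ not c
  ==-if-b         a≢b true  = ==-false (≢-sym a≢b)
  ==-if-b {b = b} _   false = ==-refl b

  ==-if-other : {a b d : Fin n} → d ≢ a → d ≢ b → ∀ c → (d == (if c then a else b)) ≡ false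
  ==-if-other d≢a d≢b true  = ==-false d≢a
  ==-if-other d≢a d≢b false = ==-false d≢b

  count-==-unique : (c : Fin n) {xs : List (Fin n)} → Unique xs → count (c ==_) xs ≤ 1
  count-==-unique c {[]}     []        = z≤n
  count-==-unique c {x ∷ xs} (x∉ ∷ u) with c ≟ x
  ... | no  _    = count-==-unique c u
  ... | yes refl = s≤s (≤-trans (sumBy-mono-All (All.map (λ c≢y → ≤-reflexive (cong 𝟙 (==-false c≢y))) x∉))
                                 (≤-reflexive (sumBy-zero xs)))

  count-∧-==ˡ : (s : Bool) (c : Fin n) → count (λ b → s ∧ (c == b)) (allFin n) ≤ 𝟙 s
  count-∧-==ˡ true  c = count-==-unique c (allFin⁺ n)
  count-∧-==ˡ false c = ≤-reflexive (sumBy-zero (allFin n))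

  count-∧-==ʳ : (s : Bool) (c : Fin n) → count (λ b → (c == b) ∧ s) (allFin n) ≤ 𝟙 s
  count-∧-==ʳ s c = subst (_≤ 𝟙 s) (sumBy-cong (allFin n) (λ b → cong 𝟙 (∧-comm s (c == b)))) (count-∧-==ˡ s c)

ends : {A : Set} → List (A × A) → List A
ends []             = []
ends ((u , v) ∷ es) = u ∷ v ∷ ends es

length-ends : {A : Set} (es : List (A × A)) → length (ends es) ≡ length es + length es
length-ends []       = refl
length-ends (e ∷ es) = cong suc (trans (cong suc (length-ends es)) (sym (+-suc (length es) (length es))))

vol : {n : ℕ} → List (Fin n × Fin n) → (Fin n → Fin n) → Fin n → ℕ
vol E f a = count (λ x → f x == a) (ends E)

potential : {n : ℕ} → List (Fin n × Fin n) → (Fin n → Fin n) → ℕ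
potential E f = sumBy (λ x → ⌈log₂ vol E f (f x) ⌉) (ends E)

count-adjacent≤vol : {n : ℕ} (E : List (Fin n × Fin n)) (f : Fin n → Fin n) (a : Fin n) →
                     count (adjacent E f a) (allFin n) ≤ vol E f a
count-adjacent≤vol {n} []             f a = ≤-reflexive (sumBy-zero (allFin n))
count-adjacent≤vol {n} ((u , v) ∷ E) f a = begin
  count (adjacent ((u , v) ∷ E) f a) (allFin n)
    ≤⟨ count-∨ _ _ (allFin n) ⟩
  count (λ b → (f u == a ∧ f v == b) ∨ (f u == b ∧ f v == a)) (allFin n) + count (adjacent E f a) (allFin n)
    ≤⟨ +-mono-≤ (count-∨ _ _ (allFin n)) (count-adjacent≤vol E f a) ⟩
  count (λ b → f u == a ∧ f v == b) (allFin n) + count (λ b → f u == b ∧ f v == a) (allFin n) + vol E f a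
    ≤⟨ +-monoˡ-≤ (vol E f a) (+-mono-≤ (count-∧-==ˡ (f u == a) (f v)) (count-∧-==ʳ (f v == a) (f u))) ⟩
  𝟙 (f u == a) + 𝟙 (f v == a) + vol E f a
    ≡⟨ +-assoc (𝟙 (f u == a)) (𝟙 (f v == a)) (vol E f a) ⟩
  vol ((u , v) ∷ E) f a ∎
  where open ≤-Reasoning

degree≤vol : {n : ℕ} (E : List (Fin n × Fin n)) (f : Fin n → Fin n) (a : Fin n) → degree E f a ≤ vol E f a
degree≤vol {n} E f a = begin
  degree E f a                                           ≡⟨ length-filter-T? (λ b → not (b == a) ∧ adjacent E f a b) (allFin n) ⟩
  count (λ b → not (b == a) ∧ adjacent E f a b) (allFin n) ≤⟨ count-∧ˡ (λ b → not (b == a)) (adjacent E f a) (allFin n) ⟩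
  count (adjacent E f a) (allFin n)                      ≤⟨ count-adjacent≤vol E f a ⟩
  vol E f a                                              ∎
  where open ≤-Reasoning

⌈log₂⌉-double : ∀ {x y} → 0 < x → x ≤ y → 1 + ⌈log₂ x ⌉ ≤ ⌈log₂ (x + y) ⌉
⌈log₂⌉-double {suc x} {y} _ x≤y = begin
  1 + ⌈log₂ suc x ⌉    ≡⟨ ⌈log₂2*n⌉≡1+⌈log₂n⌉ (suc x) ⟨
  ⌈log₂ (2 * suc x) ⌉  ≤⟨ ⌈log₂⌉-mono-≤ (+-monoʳ-≤ (suc x) (≤-trans (≤-reflexive (+-identityʳ (suc x))) x≤y)) ⟩
  ⌈log₂ (suc x + y) ⌉  ∎
  where open ≤-Reasoning

⌈log₂⌉-gainˡ : ∀ {x} y → 0 < x → ⌈log₂ x ⌉ + 𝟙 (x ≤ᵇ y) ≤ ⌈log₂ (x + y) ⌉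
⌈log₂⌉-gainˡ {x} y 0<x with x ≤ᵇ y | ≤ᵇ-reflects-≤ x y
... | true  | ofʸ x≤y = subst (_≤ ⌈log₂ (x + y) ⌉) (+-comm 1 ⌈log₂ x ⌉) (⌈log₂⌉-double 0<x x≤y)
... | false | ofⁿ _   = subst (_≤ ⌈log₂ (x + y) ⌉) (sym (+-identityʳ ⌈log₂ x ⌉)) (⌈log₂⌉-mono-≤ (m≤m+n x y))

⌈log₂⌉-gainʳ : ∀ x {y} → 0 < y → ⌈log₂ y ⌉ + 𝟙 (not (x ≤ᵇ y)) ≤ ⌈log₂ (x + y) ⌉
⌈log₂⌉-gainʳ x {y} 0<y with x ≤ᵇ y | ≤ᵇ-reflects-≤ x y
... | true  | ofʸ _   = subst (_≤ ⌈log₂ (x + y) ⌉) (sym (+-identityʳ ⌈log₂ y ⌉)) (⌈log₂⌉-mono-≤ (m≤n+m y x))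
... | false | ofⁿ x≰y = subst₂ _≤_ (+-comm 1 ⌈log₂ y ⌉) (cong ⌈log₂_⌉ (+-comm y x)) (⌈log₂⌉-double 0<y (<⇒≤ (≰⇒> x≰y)))

module _ {n : ℕ} (E : List (Fin n × Fin n)) (f : Fin n → Fin n) {a b : Fin n} (a≢b : a ≢ b) where

  vol-merge-into : vol E (merge f a b) a ≡ vol E f a + vol E f b
  vol-merge-into = trans (sumBy-cong (ends E) 𝟙-merge) (sumBy-+ _ _ (ends E))
    where
    𝟙-merge : ∀ x → 𝟙 (merge f a b x == a) ≡ 𝟙 (f x == a) + 𝟙 (f x == b)
    𝟙-merge x with f x ≟ b
    ... | yes fx≡b rewrite fx≡b | ==-refl a | ==-false (≢-sym a≢b) = refl
    ... | no  _    = sym (+-identityʳ _)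

  vol-merge-other : ∀ {c} → c ≢ a → c ≢ b → vol E (merge f a b) c ≡ vol E f c
  vol-merge-other {c} c≢a c≢b = sumBy-cong (ends E) 𝟙-merge
    where
    𝟙-merge : ∀ x → 𝟙 (merge f a b x == c) ≡ 𝟙 (f x == c)
    𝟙-merge x with f x ≟ b
    ... | yes fx≡b rewrite fx≡b | ==-false (≢-sym c≢a) | ==-false (≢-sym c≢b) = refl
    ... | no  _    = refl

  private
    va vb : ℕ
    va = vol E f a
    vb = vol E f b

  smaller : Fin n
  smaller = if va ≤ᵇ vb then a else b

  vol-smaller : va ⊓ vb ≤ vol E f smaller
  vol-smaller = subst (va ⊓ vb ≤_) (sym (if-float (vol E f) (va ≤ᵇ vb))) (⊓≤if (≤ᵇ-reflects-≤ va vb))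
    where
    ⊓≤if : ∀ {c} → Reflects (va ≤ vb) c → va ⊓ vb ≤ (if c then va else vb)
    ⊓≤if (ofʸ _) = m⊓n≤m va vb
    ⊓≤if (ofⁿ _) = m⊓n≤n va vb

  ⌈log₂vol⌉-gain : ∀ {x} → x ∈ ends E →
    ⌈log₂ vol E f (f x) ⌉ + 𝟙 (f x == smaller) ≤ ⌈log₂ vol E (merge f a b) (merge f a b x) ⌉
  -- Abstracting f x ≟ b also evaluates merge f a b x in the goal.
  ⌈log₂vol⌉-gain {x} x∈ with f x ≟ b | f x ≟ a
  ... | yes fx≡b | _ = begin
    ⌈log₂ vol E f (f x) ⌉ + 𝟙 (f x == smaller)      ≡⟨ cong (λ c → ⌈log₂ vol E f c ⌉ + 𝟙 (c == smaller)) fx≡b ⟩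
    ⌈log₂ vb ⌉ + 𝟙 (b == smaller)                   ≡⟨ cong (λ t → ⌈log₂ vb ⌉ + 𝟙 t) (==-if-b a≢b (va ≤ᵇ vb)) ⟩
    ⌈log₂ vb ⌉ + 𝟙 (not (va ≤ᵇ vb))                 ≤⟨ ⌈log₂⌉-gainʳ va (count-∈ (λ y → f y == b) x∈ (dec-true (f x ≟ b) fx≡b)) ⟩
    ⌈log₂ (va + vb) ⌉                               ≡⟨ cong ⌈log₂_⌉ vol-merge-into ⟨
    ⌈log₂ vol E (merge f a b) a ⌉                   ∎
    where open ≤-Reasoning
  ... | no  _    | yes fx≡a = begin
    ⌈log₂ vol E f (f x) ⌉ + 𝟙 (f x == smaller)      ≡⟨ cong (λ c → ⌈log₂ vol E f c ⌉ + 𝟙 (c == smaller)) fx≡a ⟩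
    ⌈log₂ va ⌉ + 𝟙 (a == smaller)                   ≡⟨ cong (λ t → ⌈log₂ va ⌉ + 𝟙 t) (==-if-a a≢b (va ≤ᵇ vb)) ⟩
    ⌈log₂ va ⌉ + 𝟙 (va ≤ᵇ vb)                       ≤⟨ ⌈log₂⌉-gainˡ vb (count-∈ (λ y → f y == a) x∈ (dec-true (f x ≟ a) fx≡a)) ⟩
    ⌈log₂ (va + vb) ⌉                               ≡⟨ cong ⌈log₂_⌉ vol-merge-into ⟨
    ⌈log₂ vol E (merge f a b) a ⌉                   ≡⟨ cong (λ c → ⌈log₂ vol E (merge f a b) c ⌉) fx≡a ⟨
    ⌈log₂ vol E (merge f a b) (f x) ⌉               ∎
    where open ≤-Reasoning
  ... | no  fx≢b | no  fx≢a = begin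
    ⌈log₂ vol E f (f x) ⌉ + 𝟙 (f x == smaller)      ≡⟨ cong (λ t → ⌈log₂ vol E f (f x) ⌉ + 𝟙 t) (==-if-other fx≢a fx≢b (va ≤ᵇ vb)) ⟩
    ⌈log₂ vol E f (f x) ⌉ + 0                       ≡⟨ +-identityʳ _ ⟩
    ⌈log₂ vol E f (f x) ⌉                           ≡⟨ cong ⌈log₂_⌉ (vol-merge-other fx≢a fx≢b) ⟨
    ⌈log₂ vol E (merge f a b) (f x) ⌉               ∎
    where open ≤-Reasoning

  potential-merge : degree E f a ⊓ degree E f b + potential E f ≤ potential E (merge f a b)
  potential-merge = begin
    degree E f a ⊓ degree E f b + potential E f
      ≤⟨ +-monoˡ-≤ (potential E f) (≤-trans (⊓-mono-≤ (degree≤vol E f a) (degree≤vol E f b)) vol-smaller) ⟩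
    vol E f smaller + potential E f
      ≡⟨ +-comm (vol E f smaller) (potential E f) ⟩
    potential E f + vol E f smaller
      ≡⟨ sumBy-+ (λ x → ⌈log₂ vol E f (f x) ⌉) (λ x → 𝟙 (f x == smaller)) (ends E) ⟨
    sumBy (λ x → ⌈log₂ vol E f (f x) ⌉ + 𝟙 (f x == smaller)) (ends E)
      ≤⟨ sumBy-mono-All (All.tabulate ⌈log₂vol⌉-gain) ⟩
    potential E (merge f a b) ∎
    where open ≤-Reasoning

potential≤ : {n : ℕ} (E : List (Fin n × Fin n)) (f : Fin n → Fin n) →
             potential E f ≤ length (ends E) * ⌈log₂ length (ends E) ⌉
potential≤ E f = sumBy-≤-length* (ends E) (λ x → ⌈log₂⌉-mono-≤ (count≤length (λ y → f y == f x) (ends E)))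

totalCost+potential≤ : {n : ℕ} (E : List (Fin n × Fin n)) (f : Fin n → Fin n) (ms : List (Fin n × Fin n)) →
                       ValidMerges f ms →
                       totalCost E f ms + potential E f ≤ length (ends E) * ⌈log₂ length (ends E) ⌉
totalCost+potential≤ E f []             _                   = potential≤ E f
totalCost+potential≤ E f ((a , b) ∷ ms) (a≢b , _ , _ , valid) = begin
  d + totalCost E f′ ms + potential E f  ≡⟨ xy∙z≈xz∙y +-commutativeSemigroup d (totalCost E f′ ms) (potential E f) ⟩
  d + potential E f + totalCost E f′ ms  ≤⟨ +-monoˡ-≤ (totalCost E f′ ms) (potential-merge E f a≢b) ⟩
  potential E f′ + totalCost E f′ ms     ≡⟨ +-comm (potential E f′) (totalCost E f′ ms) ⟩
  totalCost E f′ ms + potential E f′     ≤⟨ totalCost+potential≤ E f′ ms valid ⟩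
  length (ends E) * ⌈log₂ length (ends E) ⌉ ∎
  where
  open ≤-Reasoning
  f′ = merge f a b
  d  = degree E f a ⊓ degree E f b

length≤n*n : {n : ℕ} {E : List (Fin n × Fin n)} → Unique E → length E ≤ n * n
length≤n*n {n} {E} unique = injective⇒≤ {f = λ i → uncurry combine (lookup E i)} injective
  where
  injective : Injective _≡_ _≡_ (λ i → uncurry combine (lookup E i))
  injective eq = lookup-injective unique (×-≡,≡→≡ (combine-injective _ _ _ _ eq))

n≤2*⌈n/2⌉ : ∀ n → n ≤ 2 * ⌈ n /2⌉
n≤2*⌈n/2⌉ n = begin
  n                   ≡⟨ ⌊n/2⌋+⌈n/2⌉≡n n ⟨
  ⌊ n /2⌋ + ⌈ n /2⌉   ≤⟨ +-monoˡ-≤ ⌈ n /2⌉ (⌊n/2⌋≤⌈n/2⌉ n) ⟩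
  ⌈ n /2⌉ + ⌈ n /2⌉   ≡⟨ cong (⌈ n /2⌉ +_) (+-identityʳ ⌈ n /2⌉) ⟨
  2 * ⌈ n /2⌉         ∎
  where open ≤-Reasoning

-- Stated for an arbitrary accessibility proof, so that the defining equations of ⌈log2⌉ apply.
n≤2^⌈log2⌉n : ∀ n (rec : Acc _<_ n) → n ≤ 2 ^ ⌈log2⌉ n rec
n≤2^⌈log2⌉n 0             _        = z≤n
n≤2^⌈log2⌉n 1             _        = ≤-refl
n≤2^⌈log2⌉n (suc (suc k)) (acc rs) =
  ≤-trans (n≤2*⌈n/2⌉ (suc (suc k))) (*-monoʳ-≤ 2 (n≤2^⌈log2⌉n (suc ⌈ k /2⌉) (rs (⌈n/2⌉<n k))))

n≤2^⌈log₂n⌉ : ∀ n → n ≤ 2 ^ ⌈log₂ n ⌉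
n≤2^⌈log₂n⌉ n = n≤2^⌈log2⌉n n (<-wellFounded n)

⌈log₂[m+m]⌉≤3*⌈log₂n⌉ : ∀ {m n} → 2 ≤ n → m ≤ n * n → ⌈log₂ (m + m) ⌉ ≤ 3 * ⌈log₂ n ⌉
⌈log₂[m+m]⌉≤3*⌈log₂n⌉ {m} {n} 2≤n m≤n*n = begin
  ⌈log₂ (m + m) ⌉              ≡⟨ cong (λ t → ⌈log₂ (m + t) ⌉) (+-identityʳ m) ⟨
  ⌈log₂ (2 * m) ⌉              ≤⟨ ⌈log₂⌉-mono-≤ (*-monoʳ-≤ 2 (≤-trans m≤n*n (*-mono-≤ (n≤2^⌈log₂n⌉ n) (n≤2^⌈log₂n⌉ n)))) ⟩
  ⌈log₂ (2 * (2 ^ k * 2 ^ k)) ⌉ ≡⟨ cong (λ t → ⌈log₂ (2 * t) ⌉) (^-distribˡ-+-* 2 k k) ⟨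
  ⌈log₂ (2 ^ (1 + (k + k))) ⌉  ≡⟨ ⌈log₂2^n⌉≡n (1 + (k + k)) ⟩
  1 + (k + k)                  ≤⟨ +-monoˡ-≤ (k + k) (⌈log₂⌉-mono-≤ 2≤n) ⟩
  k + (k + k)                  ≡⟨ cong (λ t → k + (k + t)) (+-identityʳ k) ⟨
  3 * k                        ∎
  where
  open ≤-Reasoning
  k = ⌈log₂ n ⌉

2≤n-of-edge : {n : ℕ} {u v : Fin n} → toℕ u < toℕ v → 2 ≤ n
2≤n-of-edge {v = v} u<v = ≤-trans (s≤s (s≤s z≤n)) (≤-trans (s≤s u<v) (toℕ<n v))

totalCost≤6*m*⌈log₂n⌉ : (n : ℕ) (E : List (Fin n × Fin n)) → SimpleEdges E →
                        (ms : List (Fin n × Fin n)) → ValidMerges id ms →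
                        totalCost E id ms ≤ 6 * length E * ⌈log₂ n ⌉
totalCost≤6*m*⌈log₂n⌉ n []        _                  ms valid =
  ≤-trans (m≤m+n _ _) (totalCost+potential≤ [] id ms valid)
totalCost≤6*m*⌈log₂n⌉ n E@(_ ∷ _) (u<v ∷ _ , unique) ms valid = begin
  totalCost E id ms                          ≤⟨ m≤m+n _ _ ⟩
  totalCost E id ms + potential E id         ≤⟨ totalCost+potential≤ E id ms valid ⟩
  length (ends E) * ⌈log₂ length (ends E) ⌉  ≡⟨ cong (λ ℓ → ℓ * ⌈log₂ ℓ ⌉) (length-ends E) ⟩
  (m + m) * ⌈log₂ (m + m) ⌉                  ≤⟨ *-monoʳ-≤ (m + m) (⌈log₂[m+m]⌉≤3*⌈log₂n⌉ (2≤n-of-edge u<v) (length≤n*n unique)) ⟩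
  (m + m) * (3 * ⌈log₂ n ⌉)                  ≡⟨ solve 2 (λ m k → (m :+ m) :* (con 3 :* k) := con 6 :* m :* k) refl m ⌈log₂ n ⌉ ⟩
  6 * m * ⌈log₂ n ⌉                          ∎
  where
  open ≤-Reasoning
  open +-*-Solver
  m = length E

mainTheorem2 : (c : ℕ) → Σ ℕ λ C →
    (n : ℕ) (E : List (Fin n × Fin n)) → SimpleEdges E →
    n ≤ c * length E →
    (ms : List (Fin n × Fin n)) → length ms ≡ n ∸ 1 → ValidMerges id ms →
    totalCost E id ms ≤ C * length E * ⌈log₂ n ⌉
mainTheorem2 _ = 6 , λ n E simple _ ms _ valid → totalCost≤6*m*⌈log₂n⌉ n E simple ms valid
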